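{- Let $G$ be a connected simple graph, $u$ a cut-vertex of $G$, and $C$ the vertex set of some connected component of $G-u$. Let $G_1=G[C\cup\{u\}]$ and $G_2=G-C$. Then $$\mathrm{hn}_{cc}(G_1)+\mathrm{hn}_{cc}(G_2)-1\le \mathrm{hn}_{cc}(G)\le \mathrm{hn}_{cc}(G_1)+\mathrm{hn}_{cc}(G_2).$$
   Context: A cut-vertex is a vertex whose removal increases the number of connected components. $G[X]$ is the subgraph induced by $X$, and $G-C$ is $G[V(G)\setminus C]$. A cycle is a closed walk $(v_1,\dots,v_q,v_1)$ with at least one edge in which the only repeated vertex is $v_1$. For $S\subseteq V(G)$, $I_{cc}(S)=S\cup\{x\in V(G): \text{there is a cycle } C' \text{ of } G \text{ with } V(C')\setminus S=\{x\}\}$. A set $X$ is convex if $I_{cc}(X)=X$; $\mathrm{hull}(X)$ is the smallest convex set containing $X$; $X$ is a hull set if $\mathrm{hull}(X)=V(G)$; $\mathrm{hn}_{cc}(G)$ is the minimum cardinality of a hull set. -}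

module Defs where

open import Data.Nat using (ℕ; zero; suc; _+_; _≤_)
open import Data.Bool using (Bool; true; false)
open import Data.Fin using (Fin; zero; suc; inject₁; fromℕ)
open import Data.Fin.Subset using (Subset; _∈_; _∉_; _⊆_; ∣_∣)
open import Data.Product using (Σ; ∃; ∃-syntax; _×_; _,_)
open import Data.Sum using (_⊎_)
open import Relation.Binary.PropositionalEquality using (_≡_; _≢_)
open import Relation.Nullary using (¬_)
open import Function.Definitions using (Injective)

record Graph (n : ℕ) : Set where
  field
    Adj   : Fin n → Fin n → Bool
    sym   : ∀ x y → Adj x y ≡ Adj y x
    irrefl : ∀ x → Adj x x ≡ false
open Graph public

module _ {n : ℕ} (G : Graph n) where

  -- All notions below are relative to the induced subgraph G[W], W ⊆ V(G).

  data Walk (W : Subset n) : Fin n → Fin n → Set where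
    []  : ∀ {x} → x ∈ W → Walk W x x
    _∷_ : ∀ {x y z} → (x ∈ W × Adj G x y ≡ true) → Walk W y z → Walk W x z

  Connected : Subset n → Set
  Connected W = (∃[ x ] x ∈ W) × (∀ x y → x ∈ W → y ∈ W → Walk W x y)

  IsComponent : Subset n → Subset n → Set
  IsComponent W C =
    C ⊆ W × (∃[ x ] x ∈ C) × (∀ x y → x ∈ C → y ∈ C → Walk W x y)
    × (∀ x y → x ∈ C → Walk W x y → y ∈ C)

  -- u is a cut-vertex of G[W]: removing u increases the number of components,
  -- i.e. some two vertices of W - u connected in G[W] are disconnected in G[W - u].
  IsCutVertex : Subset n → Fin n → Set
  IsCutVertex W u = u ∈ W × ∃[ x ] ∃[ y ]
    (x ∈ W × y ∈ W × x ≢ u × y ≢ u × Walk W x y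
      × ¬ Walk (Data.Fin.Subset._-_ W u) x y)

  record Cycle (W : Subset n) : Set where
    field
      m      : ℕ
      vtx    : Fin (3 + m) → Fin n
      inj    : Injective _≡_ _≡_ vtx
      inW    : ∀ i → vtx i ∈ W
      edge   : ∀ (i : Fin (2 + m)) → Adj G (vtx (inject₁ i)) (vtx (suc i)) ≡ true
      close  : Adj G (vtx (fromℕ (2 + m))) (vtx zero) ≡ true

  OnCycle : {W : Subset n} → Cycle W → Fin n → Set
  OnCycle c x = ∃[ i ] Cycle.vtx c i ≡ x

  InIcc : Subset n → Subset n → Fin n → Set
  InIcc W S x = x ∈ S ⊎ (x ∈ W × Σ (Cycle W) λ c →
      OnCycle c x × x ∉ S × (∀ y → OnCycle c y → y ∉ S → y ≡ x))

  Convex : Subset n → Subset n → Set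
  Convex W X = X ⊆ W × (∀ x → InIcc W X x → x ∈ X) × (∀ x → x ∈ X → InIcc W X x)

  -- X is a hull set of G[W]: hull(X), the smallest convex set containing X,
  -- is all of W (equivalently every convex superset of X contains W).
  IsHullSet : Subset n → Subset n → Set
  IsHullSet W X = X ⊆ W × (∀ Y → Convex W Y → X ⊆ Y → W ⊆ Y)

  IsHullNumber : Subset n → ℕ → Set
  IsHullNumber W k = (∃[ X ] (IsHullSet W X × ∣ X ∣ ≡ k))
    × (∀ X → IsHullSet W X → k ≤ ∣ X ∣)

-- G is G₁ = G[C ∪ {u}] and G₂ = G[∁ C] glued at u, with no edge between C and ∁ C ∖ {u}.
-- Membership in C spreads along edges that avoid u, hence around any cycle, so every cycle of G
-- lies in G₁ or in G₂. Therefore a convex set of G meets V(Gᵢ) in a convex set of Gᵢ, and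
-- convex sets Y₁ of G₁ and Y₂ of G₂ that agree at u glue to the convex set Y₁ ∪ Y₂ of G.
-- The first fact makes the union of hull sets of G₁ and G₂ a hull set of G.
-- For the lower bound split a minimum hull set X of G into S₁ = X ∩ V(G₁) and S₂ = X ∖ V(G₁).
-- A convex Yᵢ ⊇ Sᵢ of Gᵢ containing u glues with V(G₃₋ᵢ) to a convex superset of X, so Yᵢ = V(Gᵢ):
-- thus Sᵢ ∪ {u} is a hull set of Gᵢ, and if neither Sᵢ alone is one, there are convex
-- Y₁ ⊇ S₁ and Y₂ ⊇ S₂ missing u, and Y₁ ∪ Y₂ is a convex superset of X missing u.
module Submission where

open import Defs hiding (sym)
open import Data.Nat using (ℕ; suc; _+_; _≤_; _<_; _≤′_; ≤′-refl; ≤′-step; z≤n; s≤s; _≤?_)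
open import Data.Nat.Properties
  using (≤-refl; ≤-trans; ≤-reflexive; ≤-total; <⇒≱; <-cmp; n≤1+n; m≤n⇒m≤1+n; m≤n⇒m<n∨m≡n;
         ≤⇒≤′; ≤′⇒≤; ≤-<-trans; <⇒≤; +-comm; +-suc; +-mono-≤; module ≤-Reasoning)
open import Data.Nat.DivMod using (_mod_; m<n⇒m%n≡m; n%n≡0)
open import Data.Fin using (Fin; toℕ; inject₁; fromℕ; fromℕ<; _≟_)
open import Data.Fin.Properties using (toℕ-injective; toℕ-fromℕ<; toℕ-fromℕ; toℕ-inject₁; toℕ<n; any?)
open import Data.Fin.Subset using (Subset; ⊤; ∁; _∪_; _∩_; ⁅_⁆; _-_; _─_; _∈_; _∉_; _⊆_; ∣_∣; inside; outside)
open import Data.Fin.Subset.Properties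
  using (_∈?_; ∈⊤; x∈⁅x⁆; x∈⁅y⁆⇒x≡y; x∉⁅y⁆⇒x≢y; x∈p∧x≢y⇒x∈p-y; p─q⊆p; x∈p∪q⁺; x∈p∪q⁻;
         x∈p∩q⁺; x∈p∩q⁻; x∈∁p⇒x∉p; x∉p⇒x∈∁p; ∣⁅x⁆∣≡1)
open import Data.Product using (_×_; _,_; proj₁; proj₂)
open import Data.Sum using (_⊎_; inj₁; inj₂; [_,_])
import Data.Sum as Sum
open import Data.Empty using (⊥-elim)
open import Data.Bool using (true)
open import Data.Vec using (_∷_; []; here; there)
open import Function using (_∘_; id; flip; _⇔_; mk⇔; Equivalence)
import Function.Properties.Equivalence as ⇔
open import Relation.Nullary using (¬_; yes; no; contradiction)
open import Relation.Nullary.Decidable using (decidable-stable)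
open import Relation.Binary.Definitions using (tri<; tri≈; tri>)
open import Relation.Binary.PropositionalEquality using (_≡_; _≢_; refl; sym; trans; cong; subst; subst₂; module ≡-Reasoning)

x∈p─q⇒x∉q : ∀ {k} {x : Fin k} (p q : Subset k) → x ∈ p ─ q → x ∉ q
x∈p─q⇒x∉q (inside ∷ p) (outside ∷ q) here ()
x∈p─q⇒x∉q (_ ∷ p) (_ ∷ q) (there x∈) (there y∈) = x∈p─q⇒x∉q p q x∈ y∈

x∈p-y⇒x≢y : ∀ {k} {x y : Fin k} (p : Subset k) → x ∈ p - y → x ≢ y
x∈p-y⇒x≢y p = x∉⁅y⁆⇒x≢y ∘ x∈p─q⇒x∉q p ⁅ _ ⁆

∣p∪q∣≤∣p∣+∣q∣ : ∀ {k} (p q : Subset k) → ∣ p ∪ q ∣ ≤ ∣ p ∣ + ∣ q ∣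
∣p∪q∣≤∣p∣+∣q∣ [] [] = z≤n
∣p∪q∣≤∣p∣+∣q∣ (outside ∷ p) (outside ∷ q) = ∣p∪q∣≤∣p∣+∣q∣ p q
∣p∪q∣≤∣p∣+∣q∣ (outside ∷ p) (inside ∷ q) = ≤-trans (s≤s (∣p∪q∣≤∣p∣+∣q∣ p q)) (≤-reflexive (sym (+-suc _ _)))
∣p∪q∣≤∣p∣+∣q∣ (inside ∷ p) (outside ∷ q) = s≤s (∣p∪q∣≤∣p∣+∣q∣ p q)
∣p∪q∣≤∣p∣+∣q∣ (inside ∷ p) (inside ∷ q) =
  s≤s (≤-trans (∣p∪q∣≤∣p∣+∣q∣ p q) (≤-trans (n≤1+n _) (≤-reflexive (sym (+-suc _ _)))))

∣p∪⁅x⁆∣≤1+∣p∣ : ∀ {k} (p : Subset k) (x : Fin k) → ∣ p ∪ ⁅ x ⁆ ∣ ≤ suc ∣ p ∣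
∣p∪⁅x⁆∣≤1+∣p∣ p x =
  ≤-trans (∣p∪q∣≤∣p∣+∣q∣ p ⁅ x ⁆) (≤-reflexive (trans (cong (∣ p ∣ +_) (∣⁅x⁆∣≡1 x)) (+-comm ∣ p ∣ 1)))

∣p∩q∣+∣p∩∁q∣≡∣p∣ : ∀ {k} (p q : Subset k) → ∣ p ∩ q ∣ + ∣ p ∩ ∁ q ∣ ≡ ∣ p ∣
∣p∩q∣+∣p∩∁q∣≡∣p∣ [] [] = refl
∣p∩q∣+∣p∩∁q∣≡∣p∣ (outside ∷ p) (outside ∷ q) = ∣p∩q∣+∣p∩∁q∣≡∣p∣ p q
∣p∩q∣+∣p∩∁q∣≡∣p∣ (outside ∷ p) (inside ∷ q) = ∣p∩q∣+∣p∩∁q∣≡∣p∣ p q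
∣p∩q∣+∣p∩∁q∣≡∣p∣ (inside ∷ p) (outside ∷ q) = trans (+-suc _ _) (cong suc (∣p∩q∣+∣p∩∁q∣≡∣p∣ p q))
∣p∩q∣+∣p∩∁q∣≡∣p∣ (inside ∷ p) (inside ∷ q) = cong suc (∣p∩q∣+∣p∩∁q∣≡∣p∣ p q)

∈-via-meet : ∀ {k} {A B P Q : Subset k} {u y : Fin k}
  → (∀ {x} → x ∈ A → x ∈ B → x ≡ u) → Q ⊆ B → (u ∈ Q → u ∈ P) → y ∈ A → y ∈ Q → y ∈ P
∈-via-meet meet Q⊆B u∈Q⇒u∈P y∈A y∈Q with meet y∈A (Q⊆B y∈Q)
... | refl = u∈Q⇒u∈P y∈Q

module _ {n : ℕ} (G : Graph n) where

  onCycle⇒∈ : ∀ {W x} (c : Cycle G W) → OnCycle G c x → x ∈ W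
  onCycle⇒∈ c (i , refl) = Cycle.inW c i

  cycle-within : ∀ {W W′} (c : Cycle G W) → (∀ {x} → OnCycle G c x → x ∈ W′) → Cycle G W′
  cycle-within c on⇒∈ = record
    { m = m ; vtx = vtx ; inj = inj ; inW = λ i → on⇒∈ (i , refl) ; edge = edge ; close = close }
    where open Cycle c

  module _ (P : Fin n → Set) (w : Fin n)
           (closed : ∀ {x y} → P x → Adj G x y ≡ true → y ≢ w → P y) where

    -- Indexing the cycle by ℕ modulo its length N makes v 0, v 1, …, v N a closed walk (v N = v 0).
    module _ {W : Subset n} (c : Cycle G W) where
      open Cycle c

      private
        N : ℕ
        N = 3 + m

        v : ℕ → Fin n
        v l = vtx (l mod N)

        v-at : ∀ {l} (i : Fin N) → toℕ i ≡ l → v l ≡ vtx i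
        v-at i refl = cong vtx (toℕ-injective (trans (toℕ-fromℕ< _) (m<n⇒m%n≡m (toℕ<n i))))

        v-wrap : v N ≡ v 0
        v-wrap = cong vtx (toℕ-injective (trans (toℕ-fromℕ< _) (n%n≡0 N)))

        v-injective : ∀ {a b} → a < N → b < N → v a ≡ v b → a ≡ b
        v-injective {a} {b} a<N b<N e = begin
          a              ≡⟨ sym (trans (toℕ-fromℕ< _) (m<n⇒m%n≡m a<N)) ⟩
          toℕ (a mod N)  ≡⟨ cong toℕ (inj e) ⟩
          toℕ (b mod N)  ≡⟨ trans (toℕ-fromℕ< _) (m<n⇒m%n≡m b<N) ⟩
          b              ∎
          where open ≡-Reasoning

        v-adjacent : ∀ l → l < N → Adj G (v l) (v (suc l)) ≡ true
        v-adjacent l l<N with m≤n⇒m<n∨m≡n l<N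
        ... | inj₁ (s≤s sl<N) = subst₂ (λ x y → Adj G x y ≡ true)
                (sym (v-at (inject₁ i) (trans (toℕ-inject₁ i) (toℕ-fromℕ< sl<N))))
                (sym (v-at (Data.Fin.suc i) (cong suc (toℕ-fromℕ< sl<N))))
                (edge i)
          where i = fromℕ< sl<N
        ... | inj₂ refl = subst₂ (λ x y → Adj G x y ≡ true) (sym (v-at (fromℕ (2 + m)) (toℕ-fromℕ (2 + m))))
                (trans (sym (v-at Data.Fin.zero refl)) (sym v-wrap)) close

        Avoids : ℕ → ℕ → Set
        Avoids a b = ∀ l → a ≤ l → l ≤ b → v l ≢ w

        step : ∀ l → l < N → v l ≢ w → v (suc l) ≢ w → P (v l) ⇔ P (v (suc l))
        step l l<N vl≢w vsl≢w = mk⇔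
          (λ p → closed p (v-adjacent l l<N) vsl≢w)
          (λ p → closed p (trans (Graph.sym G _ _) (v-adjacent l l<N)) vl≢w)

        along′ : ∀ {a b} → a ≤′ b → b ≤ N → Avoids a b → P (v a) ⇔ P (v b)
        along′ ≤′-refl _ _ = ⇔.refl
        along′ {a} (≤′-step {b} a≤′b) b<N avoids = ⇔.trans
          (along′ a≤′b (≤-trans (n≤1+n b) b<N) (λ l a≤l l≤b → avoids l a≤l (m≤n⇒m≤1+n l≤b)))
          (step b b<N (avoids b a≤b (n≤1+n b)) (avoids (suc b) (m≤n⇒m≤1+n a≤b) ≤-refl))
          where a≤b = ≤′⇒≤ a≤′b

        along : ∀ {a b} → a ≤ b → b ≤ N → Avoids a b → P (v a) ⇔ P (v b)
        along = along′ ∘ ≤⇒≤′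

        v-toℕ : ∀ i → v (toℕ i) ≡ vtx i
        v-toℕ i = v-at i refl

        avoids-off : ∀ {k a b} → vtx k ≡ w → b < N → (∀ {l} → a ≤ l → l ≤ b → l ≢ toℕ k) → Avoids a b
        avoids-off {k} vk≡w b<N ≢k l a≤l l≤b vl≡w = ≢k a≤l l≤b
          (v-injective (≤-<-trans l≤b b<N) (toℕ<n k) (trans vl≡w (sym (trans (v-toℕ k) vk≡w))))

        via-vtx : ∀ {i j} → P (v (toℕ i)) ⇔ P (v (toℕ j)) → P (vtx i) ⇔ P (vtx j)
        via-vtx {i} {j} = subst₂ (λ x y → P x ⇔ P y) (v-toℕ i) (v-toℕ j)

        direct : ∀ {i j} → toℕ i ≤ toℕ j → Avoids (toℕ i) (toℕ j) → P (vtx i) ⇔ P (vtx j)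
        direct {j = j} i≤j = via-vtx ∘ along i≤j (<⇒≤ (toℕ<n j))

        linked : ∀ i j → toℕ i ≤ toℕ j → vtx i ≢ w → vtx j ≢ w → P (vtx i) ⇔ P (vtx j)
        linked i j i≤j vi≢w vj≢w with any? (λ k → vtx k ≟ w)
        ... | no ∄k = direct i≤j (λ l _ _ vl≡w → ∄k (l mod N , vl≡w))
        ... | yes (k , vk≡w) with <-cmp (toℕ k) (toℕ i) | <-cmp (toℕ k) (toℕ j)
        ... | tri≈ _ k≡i _ | _ = contradiction (trans (cong vtx (toℕ-injective (sym k≡i))) vk≡w) vi≢w
        ... | _ | tri≈ _ k≡j _ = contradiction (trans (cong vtx (toℕ-injective (sym k≡j))) vk≡w) vj≢w
        ... | tri< k<i _ _ | _ =
          direct i≤j (avoids-off vk≡w (toℕ<n j) (λ i≤l _ l≡k → <⇒≱ k<i (subst (toℕ i ≤_) l≡k i≤l)))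
        ... | _ | tri> _ _ j<k =
          direct i≤j (avoids-off vk≡w (toℕ<n j) (λ _ l≤j l≡k → <⇒≱ j<k (subst (_≤ toℕ j) l≡k l≤j)))
        ... | tri> _ _ i<k | tri< k<j _ _ = via-vtx (⇔.trans i⇔0 (⇔.trans 0⇔N (⇔.sym j⇔N)))
          where
            -- w sits strictly between i and j, so go the other way round: along 0 … i and j … N.
            avoids-0-i : Avoids 0 (toℕ i)
            avoids-0-i = avoids-off vk≡w (toℕ<n i) (λ _ l≤i l≡k → <⇒≱ i<k (subst (_≤ toℕ i) l≡k l≤i))

            avoids-j-N : Avoids (toℕ j) N
            avoids-j-N l j≤l l≤N with m≤n⇒m<n∨m≡n l≤N
            ... | inj₁ l<N = avoids-off vk≡w l<N (λ j≤l′ _ l≡k → <⇒≱ k<j (subst (toℕ j ≤_) l≡k j≤l′)) l j≤l ≤-refl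
            ... | inj₂ refl = avoids-0-i 0 z≤n z≤n ∘ trans (sym v-wrap)

            i⇔0 : P (v (toℕ i)) ⇔ P (v 0)
            i⇔0 = ⇔.sym (along z≤n (<⇒≤ (toℕ<n i)) avoids-0-i)

            0⇔N : P (v 0) ⇔ P (v N)
            0⇔N = subst (λ x → P (v 0) ⇔ P x) (sym v-wrap) ⇔.refl

            j⇔N : P (v (toℕ j)) ⇔ P (v N)
            j⇔N = along (<⇒≤ (toℕ<n j)) ≤-refl avoids-j-N

      spread : ∀ i j → vtx i ≢ w → vtx j ≢ w → P (vtx i) → P (vtx j)
      spread i j vi≢w vj≢w with ≤-total (toℕ i) (toℕ j)
      ... | inj₁ i≤j = Equivalence.to (linked i j i≤j vi≢w vj≢w)
      ... | inj₂ j≤i = Equivalence.from (linked j i j≤i vj≢w vi≢w)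

  LoneOutsider : ∀ {W} → Cycle G W → Subset n → Fin n → Set
  LoneOutsider c X x = OnCycle G c x × x ∉ X × (∀ y → OnCycle G c y → y ∉ X → y ≡ x)

  lone-outsider-cong : ∀ {W X Y x} (c : Cycle G W)
    → (∀ {y} → OnCycle G c y → y ∈ X → y ∈ Y) → (∀ {y} → OnCycle G c y → y ∈ Y → y ∈ X)
    → LoneOutsider c X x → LoneOutsider c Y x
  lone-outsider-cong c X⇒Y Y⇒X (on , x∉X , unique) =
    on , (x∉X ∘ Y⇒X on) , λ y on′ y∉Y → unique y on′ (y∉Y ∘ X⇒Y on′)

  convex⇒no-lone-outsider : ∀ {W X x} → Convex G W X → (c : Cycle G W) → ¬ LoneOutsider c X x
  convex⇒no-lone-outsider {x = x} (_ , closed , _) c lone@(on , x∉X , _) =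
    x∉X (closed x (inj₂ (onCycle⇒∈ c on , c , lone)))

  no-lone-outsider⇒convex : ∀ {W X} → X ⊆ W → (∀ (c : Cycle G W) x → ¬ LoneOutsider c X x) → Convex G W X
  no-lone-outsider⇒convex X⊆W no-lone = X⊆W , closed , λ _ → inj₁
    where
      closed : ∀ x → InIcc G _ _ x → x ∈ _
      closed x (inj₁ x∈X) = x∈X
      closed x (inj₂ (_ , c , lone)) = ⊥-elim (no-lone c x lone)

  convex-self : ∀ W → Convex G W W
  convex-self W = no-lone-outsider⇒convex (λ x∈W → x∈W) λ c x (on , x∉W , _) → x∉W (onCycle⇒∈ c on)

  ∩-convex : ∀ {W W′ Y} → W ⊆ W′ → Convex G W′ Y → Convex G W (Y ∩ W)
  ∩-convex {W} {Y = Y} W⊆W′ convexY = no-lone-outsider⇒convex (proj₂ ∘ x∈p∩q⁻ Y W) λ c x lone →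
    convex⇒no-lone-outsider convexY (cycle-within c (W⊆W′ ∘ onCycle⇒∈ c))
      (lone-outsider-cong c (λ _ → proj₁ ∘ x∈p∩q⁻ Y W) (λ on y∈Y → x∈p∩q⁺ (y∈Y , onCycle⇒∈ c on)) lone)

  hull⇒⊆convex : ∀ {W W′ X Y} → IsHullSet G W X → W ⊆ W′ → Convex G W′ Y → X ⊆ Y → W ⊆ Y
  hull⇒⊆convex {W} {Y = Y} (X⊆W , hull) W⊆W′ convexY X⊆Y =
    proj₁ ∘ x∈p∩q⁻ Y W ∘ hull (Y ∩ W) (∩-convex W⊆W′ convexY) λ x∈X → x∈p∩q⁺ (X⊆Y x∈X , X⊆W x∈X)

  record IsVertexSum (W₁ W₂ : Subset n) (u : Fin n) : Set where
    field
      cover   : ∀ x → x ∈ W₁ ⊎ x ∈ W₂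
      meet    : ∀ {x} → x ∈ W₁ → x ∈ W₂ → x ≡ u
      u∈W₁    : u ∈ W₁
      u∈W₂    : u ∈ W₂
      no-edge : ∀ {x y} → x ∈ W₁ → y ∈ W₂ → x ≢ u → y ≢ u → Adj G x y ≢ true

  vertexSum-swap : ∀ {W₁ W₂ u} → IsVertexSum W₁ W₂ u → IsVertexSum W₂ W₁ u
  vertexSum-swap σ = record
    { cover   = Sum.swap ∘ cover
    ; meet    = flip meet
    ; u∈W₁    = u∈W₂
    ; u∈W₂    = u∈W₁
    ; no-edge = λ x∈W₂ y∈W₁ x≢u y≢u adj → no-edge y∈W₁ x∈W₂ y≢u x≢u (trans (Graph.sym G _ _) adj)
    }
    where open IsVertexSum σ

  module VertexSum {W₁ W₂ u} (σ : IsVertexSum W₁ W₂ u) where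
    open IsVertexSum σ

    edge-stays : ∀ {x y} → x ∈ W₁ - u → Adj G x y ≡ true → y ≢ u → y ∈ W₁ - u
    edge-stays x∈ adj y≢u with cover _
    ... | inj₁ y∈W₁ = x∈p∧x≢y⇒x∈p-y y∈W₁ y≢u
    ... | inj₂ y∈W₂ = ⊥-elim (no-edge (p─q⊆p W₁ ⁅ u ⁆ x∈) y∈W₂ (x∈p-y⇒x≢y W₁ x∈) y≢u adj)

    cycle-side : ∀ {W} (c : Cycle G W)
      → (∀ {x} → OnCycle G c x → x ∈ W₁) ⊎ (∀ {x} → OnCycle G c x → x ∈ W₂)
    cycle-side c with any? (λ i → Cycle.vtx c i ∈? W₁ - u)
    ... | yes (i , vi∈) = inj₁ λ { (j , refl) → on-W₁ j }
      where
        on-W₁ : ∀ j → Cycle.vtx c j ∈ W₁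
        on-W₁ j with Cycle.vtx c j ≟ u
        ... | yes vj≡u = subst (_∈ W₁) (sym vj≡u) u∈W₁
        ... | no vj≢u = p─q⊆p W₁ ⁅ u ⁆
                (spread (_∈ W₁ - u) u edge-stays c i j (x∈p-y⇒x≢y W₁ vi∈) vj≢u vi∈)
    ... | no ∄i = inj₂ λ { (j , refl) → on-W₂ j }
      where
        on-W₂ : ∀ j → Cycle.vtx c j ∈ W₂
        on-W₂ j with cover (Cycle.vtx c j) | Cycle.vtx c j ≟ u
        ... | inj₂ vj∈W₂ | _ = vj∈W₂
        ... | inj₁ _ | yes vj≡u = subst (_∈ W₂) (sym vj≡u) u∈W₂
        ... | inj₁ vj∈W₁ | no vj≢u = ⊥-elim (∄i (j , x∈p∧x≢y⇒x∈p-y vj∈W₁ vj≢u))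

    ∪-convex : ∀ {Y₁ Y₂} → Convex G W₁ Y₁ → Convex G W₂ Y₂
      → (u ∈ Y₁ → u ∈ Y₂) → (u ∈ Y₂ → u ∈ Y₁) → Convex G ⊤ (Y₁ ∪ Y₂)
    ∪-convex {Y₁} {Y₂} convex₁@(Y₁⊆W₁ , _) convex₂@(Y₂⊆W₂ , _) u₁₂ u₂₁ =
      no-lone-outsider⇒convex (λ _ → ∈⊤) no-lone
      where
        no-lone : ∀ c x → ¬ LoneOutsider c (Y₁ ∪ Y₂) x
        no-lone c x lone with cycle-side c
        ... | inj₁ on⇒W₁ = convex⇒no-lone-outsider convex₁ (cycle-within c on⇒W₁)
              (lone-outsider-cong c (λ on → [ id , ∈-via-meet meet Y₂⊆W₂ u₂₁ (on⇒W₁ on) ] ∘ x∈p∪q⁻ Y₁ Y₂)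
                (λ _ → x∈p∪q⁺ ∘ inj₁) lone)
        ... | inj₂ on⇒W₂ = convex⇒no-lone-outsider convex₂ (cycle-within c on⇒W₂)
              (lone-outsider-cong c (λ on → [ ∈-via-meet (flip meet) Y₁⊆W₁ u₁₂ (on⇒W₂ on) , id ] ∘ x∈p∪q⁻ Y₁ Y₂)
                (λ _ → x∈p∪q⁺ ∘ inj₂) lone)

    ∪-hull : ∀ {X₁ X₂} → IsHullSet G W₁ X₁ → IsHullSet G W₂ X₂ → IsHullSet G ⊤ (X₁ ∪ X₂)
    ∪-hull hull₁ hull₂ = (λ _ → ∈⊤) , λ Y convexY X⊆Y {x} _ →
      [ hull⇒⊆convex hull₁ (λ _ → ∈⊤) convexY (X⊆Y ∘ x∈p∪q⁺ ∘ inj₁)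
      , hull⇒⊆convex hull₂ (λ _ → ∈⊤) convexY (X⊆Y ∘ x∈p∪q⁺ ∘ inj₂) ] (cover x)

    module _ {X S₁ S₂} (hullX : IsHullSet G ⊤ X) (S₁⊆W₁ : S₁ ⊆ W₁) (S₂⊆W₂ : S₂ ⊆ W₂)
             (split : ∀ {x} → x ∈ X → x ∈ S₁ ⊎ x ∈ S₂) where

      ⊤⊆convex-∪ : ∀ {Y₁ Y₂} → Convex G ⊤ (Y₁ ∪ Y₂) → S₁ ⊆ Y₁ → S₂ ⊆ Y₂ → ⊤ ⊆ Y₁ ∪ Y₂
      ⊤⊆convex-∪ {Y₁} {Y₂} convex S₁⊆Y₁ S₂⊆Y₂ =
        proj₂ hullX (Y₁ ∪ Y₂) convex (x∈p∪q⁺ ∘ Sum.map S₁⊆Y₁ S₂⊆Y₂ ∘ split)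

      u∈convex⇒⊇W₁ : ∀ {Y₁} → Convex G W₁ Y₁ → S₁ ⊆ Y₁ → u ∈ Y₁ → W₁ ⊆ Y₁
      u∈convex⇒⊇W₁ {Y₁} convex₁ S₁⊆Y₁ u∈Y₁ x∈W₁ =
        [ id , ∈-via-meet meet id (λ _ → u∈Y₁) x∈W₁ ]
          (x∈p∪q⁻ Y₁ W₂ (⊤⊆convex-∪ (∪-convex convex₁ (convex-self W₂) (λ _ → u∈W₂) (λ _ → u∈Y₁)) S₁⊆Y₁ S₂⊆W₂ ∈⊤))

      hull-with-u : IsHullSet G W₁ (S₁ ∪ ⁅ u ⁆)
      hull-with-u = [ S₁⊆W₁ , (λ x∈⁅u⁆ → subst (_∈ W₁) (sym (x∈⁅y⁆⇒x≡y u x∈⁅u⁆)) u∈W₁) ] ∘ x∈p∪q⁻ S₁ ⁅ u ⁆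
        , λ Y convexY ⊆Y → u∈convex⇒⊇W₁ convexY (⊆Y ∘ x∈p∪q⁺ ∘ inj₁) (⊆Y (x∈p∪q⁺ (inj₂ (x∈⁅x⁆ u))))

      u∈one-side : ∀ {Y₁ Y₂} → Convex G W₁ Y₁ → Convex G W₂ Y₂ → S₁ ⊆ Y₁ → S₂ ⊆ Y₂ → u ∈ Y₁ ⊎ u ∈ Y₂
      u∈one-side {Y₁} {Y₂} convex₁ convex₂ S₁⊆Y₁ S₂⊆Y₂ with u ∈? Y₁ | u ∈? Y₂
      ... | yes u∈Y₁ | _ = inj₁ u∈Y₁
      ... | _ | yes u∈Y₂ = inj₂ u∈Y₂
      ... | no u∉Y₁ | no u∉Y₂ = ⊥-elim ([ u∉Y₁ , u∉Y₂ ] (x∈p∪q⁻ Y₁ Y₂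
            (⊤⊆convex-∪ (∪-convex convex₁ convex₂ (⊥-elim ∘ u∉Y₁) (⊥-elim ∘ u∉Y₂)) S₁⊆Y₁ S₂⊆Y₂ ∈⊤)))

  module _ {W₁ W₂ u} (σ : IsVertexSum W₁ W₂ u) where
    open IsVertexSum σ
    open VertexSum σ
    private module σ′ = VertexSum (vertexSum-swap σ)

    hull-on-one-side : ∀ {X S₁ S₂} → IsHullSet G ⊤ X → S₁ ⊆ W₁ → S₂ ⊆ W₂ → (∀ {x} → x ∈ X → x ∈ S₁ ⊎ x ∈ S₂)
      → ¬ IsHullSet G W₁ S₁ → IsHullSet G W₂ S₂
    hull-on-one-side {S₁ = S₁} {S₂} hullX S₁⊆W₁ S₂⊆W₂ split ¬hull₁ = S₂⊆W₂ , hull₂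
      where
        hull₂ : ∀ Y₂ → Convex G W₂ Y₂ → S₂ ⊆ Y₂ → W₂ ⊆ Y₂
        hull₂ Y₂ convex₂ S₂⊆Y₂ with u ∈? Y₂
        ... | yes u∈Y₂ = σ′.u∈convex⇒⊇W₁ hullX S₂⊆W₂ S₁⊆W₁ (Sum.swap ∘ split) convex₂ S₂⊆Y₂ u∈Y₂
        ... | no u∉Y₂ = ⊥-elim (¬hull₁ (S₁⊆W₁ , hull₁))
          where
            hull₁ : ∀ Y₁ → Convex G W₁ Y₁ → S₁ ⊆ Y₁ → W₁ ⊆ Y₁
            hull₁ Y₁ convex₁ S₁⊆Y₁ with u∈one-side hullX S₁⊆W₁ S₂⊆W₂ split convex₁ convex₂ S₁⊆Y₁ S₂⊆Y₂
            ... | inj₁ u∈Y₁ = u∈convex⇒⊇W₁ hullX S₁⊆W₁ S₂⊆W₂ split convex₁ S₁⊆Y₁ u∈Y₁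
            ... | inj₂ u∈Y₂ = contradiction u∈Y₂ u∉Y₂

    hull-number-≤-sum : ∀ {h h₁ h₂} → IsHullNumber G ⊤ h → IsHullNumber G W₁ h₁ → IsHullNumber G W₂ h₂
      → h ≤ h₁ + h₂
    hull-number-≤-sum (_ , minimal) ((X₁ , hull₁ , refl) , _) ((X₂ , hull₂ , refl) , _) =
      ≤-trans (minimal _ (∪-hull hull₁ hull₂)) (∣p∪q∣≤∣p∣+∣q∣ X₁ X₂)

    sum-≤-hull-number+1 : ∀ {h h₁ h₂} → IsHullNumber G ⊤ h → IsHullNumber G W₁ h₁ → IsHullNumber G W₂ h₂
      → h₁ + h₂ ≤ h + 1
    sum-≤-hull-number+1 {h₁ = h₁} {h₂} ((X , hullX , refl) , _) (_ , minimal₁) (_ , minimal₂) =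
      subst (h₁ + h₂ ≤_) (+-comm 1 ∣ X ∣) (decidable-stable (h₁ + h₂ ≤? suc ∣ X ∣)
        λ ≰ → ≰ (bound₂ (hull-on-one-side hullX S₁⊆W₁ S₂⊆W₂ split (≰ ∘ bound₁))))
      where
        open ≤-Reasoning
        S₁ S₂ : Subset n
        S₁ = X ∩ W₁
        S₂ = X ∩ ∁ W₁

        S₁⊆W₁ : S₁ ⊆ W₁
        S₁⊆W₁ = proj₂ ∘ x∈p∩q⁻ X W₁

        S₂⊆W₂ : S₂ ⊆ W₂
        S₂⊆W₂ {x} x∈S₂ = [ ⊥-elim ∘ x∈∁p⇒x∉p (proj₂ (x∈p∩q⁻ X (∁ W₁) x∈S₂)) , id ] (cover x)

        split : ∀ {x} → x ∈ X → x ∈ S₁ ⊎ x ∈ S₂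
        split {x} x∈X with x ∈? W₁
        ... | yes x∈W₁ = inj₁ (x∈p∩q⁺ (x∈X , x∈W₁))
        ... | no x∉W₁ = inj₂ (x∈p∩q⁺ (x∈X , x∉p⇒x∈∁p x∉W₁))

        bound₁ : IsHullSet G W₁ S₁ → h₁ + h₂ ≤ suc ∣ X ∣
        bound₁ hull₁ = begin
          h₁ + h₂                ≤⟨ +-mono-≤ (minimal₁ S₁ hull₁) (≤-trans
                                      (minimal₂ _ (σ′.hull-with-u hullX S₂⊆W₂ S₁⊆W₁ (Sum.swap ∘ split)))
                                      (∣p∪⁅x⁆∣≤1+∣p∣ S₂ u)) ⟩
          ∣ S₁ ∣ + suc ∣ S₂ ∣    ≡⟨ +-suc ∣ S₁ ∣ ∣ S₂ ∣ ⟩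
          suc (∣ S₁ ∣ + ∣ S₂ ∣)  ≡⟨ cong suc (∣p∩q∣+∣p∩∁q∣≡∣p∣ X W₁) ⟩
          suc ∣ X ∣              ∎

        bound₂ : IsHullSet G W₂ S₂ → h₁ + h₂ ≤ suc ∣ X ∣
        bound₂ hull₂ = begin
          h₁ + h₂                ≤⟨ +-mono-≤ (≤-trans
                                      (minimal₁ _ (hull-with-u hullX S₁⊆W₁ S₂⊆W₂ split))
                                      (∣p∪⁅x⁆∣≤1+∣p∣ S₁ u)) (minimal₂ S₂ hull₂) ⟩
          suc ∣ S₁ ∣ + ∣ S₂ ∣    ≡⟨ cong suc (∣p∩q∣+∣p∩∁q∣≡∣p∣ X W₁) ⟩
          suc ∣ X ∣              ∎

  component⇒vertexSum : ∀ {u C} → IsComponent G (⊤ - u) C → IsVertexSum (C ∪ ⁅ u ⁆) (∁ C) u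
  component⇒vertexSum {u} {C} (C⊆⊤-u , _ , _ , walk-closed) = record
    { cover   = cover
    ; meet    = λ x∈W₁ x∈∁C → [ contradiction x∈∁C ∘ ∈C⇒∉∁C , x∈⁅y⁆⇒x≡y u ] (x∈p∪q⁻ C ⁅ u ⁆ x∈W₁)
    ; u∈W₁    = x∈p∪q⁺ (inj₂ (x∈⁅x⁆ u))
    ; u∈W₂    = x∉p⇒x∈∁p λ u∈C → ∈C⇒≢u u∈C refl
    ; no-edge = λ x∈W₁ y∈∁C x≢u y≢u adj → ∈C⇒∉∁C (edge-stays-in-C (∈C x∈W₁ x≢u) adj y≢u) y∈∁C
    }
    where
      ∈C⇒≢u : ∀ {x} → x ∈ C → x ≢ u
      ∈C⇒≢u = x∈p-y⇒x≢y ⊤ ∘ C⊆⊤-u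

      ∈C⇒∉∁C : ∀ {x} → x ∈ C → x ∉ ∁ C
      ∈C⇒∉∁C x∈C x∈∁C = x∈∁p⇒x∉p x∈∁C x∈C

      ∈C : ∀ {x} → x ∈ C ∪ ⁅ u ⁆ → x ≢ u → x ∈ C
      ∈C x∈W₁ x≢u = [ id , (λ x∈⁅u⁆ → contradiction (x∈⁅y⁆⇒x≡y u x∈⁅u⁆) x≢u) ] (x∈p∪q⁻ C ⁅ u ⁆ x∈W₁)

      edge-stays-in-C : ∀ {x y} → x ∈ C → Adj G x y ≡ true → y ≢ u → y ∈ C
      edge-stays-in-C x∈C adj y≢u =
        walk-closed _ _ x∈C ((C⊆⊤-u x∈C , adj) ∷ [] (x∈p∧x≢y⇒x∈p-y ∈⊤ y≢u))

      cover : ∀ x → x ∈ C ∪ ⁅ u ⁆ ⊎ x ∈ ∁ C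
      cover x with x ∈? C
      ... | yes x∈C = inj₁ (x∈p∪q⁺ (inj₁ x∈C))
      ... | no x∉C = inj₂ (x∉p⇒x∈∁p x∉C)

lemma2 : ∀ {n : ℕ} (G : Graph n) (u : Fin n) (C : Subset n)
    → Connected G ⊤
    → IsCutVertex G ⊤ u
    → IsComponent G (⊤ - u) C
    → ∀ (h h₁ h₂ : ℕ)
    → IsHullNumber G ⊤ h
    → IsHullNumber G (C ∪ ⁅ u ⁆) h₁
    → IsHullNumber G (∁ C) h₂
    → (h₁ + h₂ ≤ h + 1) × (h ≤ h₁ + h₂)
lemma2 G u C _ _ component _ _ _ hn hn₁ hn₂ =
  sum-≤-hull-number+1 G σ hn hn₁ hn₂ , hull-number-≤-sum G σ hn hn₁ hn₂
  where σ = component⇒vertexSum G component
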